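{- Let $G$ be a finite abelian group of order $n$ and $H$ a finite abelian group of order $m$. Let $q$ be a prime and write $n=q^\beta n'$, $m=q^\delta m'$ with $\gcd(n',q)=\gcd(m',q)=1$. Let $$\mathcal E=\{k\in\mathbb N : q^k\mid\gcd(m,n),\ \varphi_G(q^k)\ne\varphi_H(q^k)\}.$$ Suppose $\mathcal E$ is nonempty and let $t=\min\mathcal E$. If $\varphi_G(q^t)<\varphi_H(q^t)$, then $q^{t+1}\mid m$ (i.e. $\delta>t$), and moreover $$q^t\le \varphi_H(q^t)-\varphi_G(q^t)\le q^\delta-q^t.$$
   Context: $\mathbb N$ denotes the set of positive integers. For a finite group $G$ and positive integer $d$, $\varphi_G(d)$ denotes the number of elements of $G$ of order exactly $d$. -}

module Defs where

open import Data.Nat using (ℕ; zero; suc; _<_; _<?_)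
open import Data.Fin using (Fin; toℕ)
open import Data.Fin.Properties using (all?) renaming (_≟_ to _≟ᶠ_)
open import Data.List using (List; length; filter)
open import Data.List.Base using (allFin)
open import Data.Product using (_×_)
open import Relation.Binary.PropositionalEquality using (_≡_)
open import Relation.Nullary using (Dec; ¬_)
open import Relation.Nullary.Decidable using (_×-dec_; _→-dec_; ¬?)
open import Algebra.Structures using (IsAbelianGroup)

-- A finite abelian group of order n, presented on the carrier Fin n
-- (every finite abelian group of order n is isomorphic to such a structure).
record FiniteAbelianGroup (n : ℕ) : Set where
  field
    _∙_ : Fin n → Fin n → Fin n
    ε   : Fin n
    _⁻¹ : Fin n → Fin n
    isAbelianGroup : IsAbelianGroup _≡_ _∙_ ε _⁻¹

module _ {n : ℕ} (G : FiniteAbelianGroup n) where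
  open FiniteAbelianGroup G

  pow : Fin n → ℕ → Fin n
  pow g zero    = ε
  pow g (suc k) = g ∙ pow g k

  HasOrder : Fin n → ℕ → Set
  HasOrder g d = (0 < d) × (pow g d ≡ ε) × ((k : Fin d) → 0 < toℕ k → ¬ (pow g (toℕ k) ≡ ε))

  hasOrder? : (d : ℕ) (g : Fin n) → Dec (HasOrder g d)
  hasOrder? d g = (0 <? d) ×-dec ((pow g d ≟ᶠ ε) ×-dec all? (λ k → (0 <? toℕ k) →-dec ¬? (pow g (toℕ k) ≟ᶠ ε)))

  φ : ℕ → ℕ
  φ d = length (filter (hasOrder? d) (allFin n))

-- Write N_G(k) for the number of x ∈ G with x^(q^k) = e.  Then N_G(0) = 1 and
-- N_G(k+1) = N_G(k) + φ_G(q^(k+1)), so minimality of t gives N_G(t-1) = N_H(t-1) and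
-- φ_H(q^t) - φ_G(q^t) = N_H(t) - N_G(t).  By Cauchy's theorem every N(k) is a power of q; by
-- Lagrange's theorem N_H(k) ≤ q^δ; and if q^k ∣ n then N_G(k) ≥ q^k by induction on k: when
-- N_G(k) = q^a with a ≤ k, q divides the index of G[q^k] in G, so Cauchy's theorem in G/G[q^k]
-- yields an element of G[q^(k+1)] ∖ G[q^k], whence N_G(k+1) ≥ q N_G(k).  As the powers of q
-- N_G(t) < N_H(t) differ, N_H(t) ≥ q N_G(t) ≥ 2 N_G(t), and q^t ≤ N_G(t) < N_H(t) ≤ q^δ gives
-- all the claims.  Lagrange's theorem and Cauchy's theorem for quotients are proved together,
-- by adjoining one element to a subgroup at a time.
module Submission where

open import Defs
open import Data.Nat using (ℕ; _+_; _*_; _^_; _∸_; _≤_; _<_)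
open import Data.Nat.Divisibility using (_∣_)
open import Data.Nat.GCD using (gcd)
open import Data.Nat.Coprimality using (Coprime)
open import Data.Nat.Primality using (Prime)
open import Data.Product using (_×_)
open import Relation.Binary.PropositionalEquality using (_≡_)
open import Relation.Nullary using (¬_)

open import Level using (Level; 0ℓ)
open import Data.Nat
  using (zero; suc; z≤n; s≤s; s≤s⁻¹; NonZero; >-nonZero; nonTrivial⇒n>1; _≟_; _<?_)
open import Data.Nat.Properties hiding (_≟_; suc-injective)
open import Data.Nat.Divisibility
  using (divides; _∣?_; ∣1⇒≡1; ∣⇒≤; ∣-refl; ∣-trans; m∣m*n; ∣n⇒∣m*n; *-cancelʳ-∣)
open import Data.Nat.GCD using (gcd-GCD; gcd[m,n]∣m; gcd[m,n]∣n; module Bézout)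
open import Data.Nat.Coprimality using (coprime-Bézout; coprime⇒gcd≡1; coprime-divisor)
open import Data.Nat.DivMod using (_mod_; _/_; _%_; m≡m%n+[m/n]*n; m%n<n)
open import Data.Nat.Primality
  using (prime⇒irreducible; prime⇒nonTrivial; prime⇒nonZero; euclidsLemma)
open import Data.Nat.Primality.Factorisation using (factorise; PrimeFactorisation)
open import Data.Nat.ListAction using (product)
open import Data.Fin using (Fin; zero; suc; toℕ; fromℕ; fromℕ<) renaming (_≟_ to _≟ᶠ_)
open import Data.Fin.Properties
  using (any?; suc-injective; pigeonhole; toℕ<n; toℕ-fromℕ; toℕ-fromℕ<; toℕ-injective)
open import Data.Fin.Permutation using (permutation)
open import Data.List using ([]; _∷_; length; filter)
open import Data.List.Base using (allFin; tabulate)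
open import Data.List.Relation.Unary.All using (All; []; _∷_)
open import Data.Product using (_,_; ∃-syntax)
open import Data.Sum using (_⊎_; inj₁; inj₂)
open import Data.Empty using (⊥-elim)
open import Data.Unit using (⊤; tt)
open import Function using (_∘_; id)
open import Relation.Binary.PropositionalEquality
  using (_≢_; refl; sym; trans; cong; cong₂; subst; subst₂; module ≡-Reasoning)
open import Relation.Binary.Definitions using (tri<; tri≈; tri>)
open import Relation.Nullary using (Dec; yes; no; contradiction)
open import Relation.Nullary.Decidable using (_×-dec_; ¬?; decidable-stable)
open import Relation.Unary using (Pred; Decidable; _⊆_)
open import Algebra.Bundles using (AbelianGroup)
open import Algebra.Properties.CommutativeMonoid.Sum +-0-commutativeMonoid
  using (sum; sum-remove; sum-cong-≗; ∑-distrib-+; ∑-comm; sum-permute)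

private
  variable
    a : Level
    A B : Set a
    n : ℕ
    P Q : Pred (Fin n) a
    d k m p q : ℕ

𝟙 : Dec A → ℕ
𝟙 (yes _) = 1
𝟙 (no _)  = 0

𝟙-mono : (A → B) → (a? : Dec A) (b? : Dec B) → 𝟙 a? ≤ 𝟙 b?
𝟙-mono f (yes a) (yes _) = ≤-refl
𝟙-mono f (yes a) (no ¬b) = ⊥-elim (¬b (f a))
𝟙-mono f (no _)  _       = z≤n

𝟙-cong : (A → B) → (B → A) → (a? : Dec A) (b? : Dec B) → 𝟙 a? ≡ 𝟙 b?
𝟙-cong f g a? b? = ≤-antisym (𝟙-mono f a? b?) (𝟙-mono g b? a?)

𝟙-split : (A → B) → (a? : Dec A) (b? : Dec B) → 𝟙 b? ≡ 𝟙 a? + 𝟙 (b? ×-dec ¬? a?)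
𝟙-split f (yes a) (yes _) = refl
𝟙-split f (yes a) (no ¬b) = ⊥-elim (¬b (f a))
𝟙-split f (no _)  (yes _) = refl
𝟙-split f (no _)  (no _)  = refl

sum-const : ∀ n c → sum {n} (λ _ → c) ≡ n * c
sum-const zero    c = refl
sum-const (suc n) c = cong (c +_) (sum-const n c)

sum-≥ : (f : Fin n → ℕ) (i : Fin n) → f i ≤ sum f
sum-≥ {suc n} f i = subst (f i ≤_) (sym (sum-remove f)) (m≤m+n (f i) _)

count : Decidable P → ℕ
count P? = sum (λ i → 𝟙 (P? i))

length-filter-allFin : {P : Pred (Fin n) a} (P? : Decidable P) → length (filter P? (allFin n)) ≡ count P?
length-filter-allFin {n = n} P? = go n id
  where
  go : ∀ m (f : Fin m → Fin n) → length (filter P? (tabulate f)) ≡ sum (λ i → 𝟙 (P? (f i)))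
  go zero    f = refl
  go (suc m) f with P? (f zero)
  ... | yes _ = cong suc (go m (f ∘ suc))
  ... | no _  = go m (f ∘ suc)

count-cong : (P? : Decidable P) (Q? : Decidable Q) → P ⊆ Q → Q ⊆ P → count P? ≡ count Q?
count-cong P? Q? P⊆Q Q⊆P = sum-cong-≗ (λ i → 𝟙-cong P⊆Q Q⊆P (P? i) (Q? i))

count-pos : (P? : Decidable P) (i : Fin n) → P i → 0 < count P?
count-pos P? i Pi with P? i | sum-≥ (λ j → 𝟙 (P? j)) i
... | yes _ | 1≤count = 1≤count
... | no ¬Pi | _ = ⊥-elim (¬Pi Pi)

count-split : (P? : Decidable P) (Q? : Decidable Q) → P ⊆ Q →
              count Q? ≡ count P? + count (λ i → Q? i ×-dec ¬? (P? i))
count-split P? Q? P⊆Q = trans (sum-cong-≗ (λ i → 𝟙-split P⊆Q (P? i) (Q? i)))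
                              (∑-distrib-+ (λ i → 𝟙 (P? i)) _)

count-mono : (P? : Decidable P) (Q? : Decidable Q) → P ⊆ Q → count P? ≤ count Q?
count-mono P? Q? P⊆Q = subst (count P? ≤_) (sym (count-split P? Q? P⊆Q)) (m≤m+n _ _)

count-mono-< : (P? : Decidable P) (Q? : Decidable Q) → P ⊆ Q →
               (i : Fin n) → Q i → ¬ P i → count P? < count Q?
count-mono-< P? Q? P⊆Q i Qi ¬Pi = subst (count P? <_) (sym (count-split P? Q? P⊆Q))
  (m<m+n (count P?) (count-pos (λ j → Q? j ×-dec ¬? (P? j)) i (Qi , ¬Pi)))

count-universal : {P : Pred (Fin n) a} (P? : Decidable P) → (∀ i → P i) → count P? ≡ n
count-universal {n = n} P? all = trans (sum-cong-≗ (λ i → 𝟙-cong _ (λ _ → all i) (P? i) (yes tt)))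
                                       (trans (sum-const n 1) (*-identityʳ n))

count-empty : {P : Pred (Fin n) a} (P? : Decidable P) → (∀ i → ¬ P i) → count P? ≡ 0
count-empty {n = n} P? none = trans (sum-cong-≗ (λ i → 𝟙-cong (none i) ⊥-elim (P? i) (no id)))
                                    (trans (sum-const n 0) (*-zeroʳ n))

count-singleton : (i : Fin n) → count (_≟ᶠ i) ≡ 1
count-singleton {suc n} zero    = cong suc (count-empty {n = n} (λ j → suc j ≟ᶠ zero) (λ _ ()))
count-singleton {suc n} (suc i) =
  trans (sum-cong-≗ (λ j → 𝟙-cong suc-injective (cong suc) (suc j ≟ᶠ suc i) (j ≟ᶠ i))) (count-singleton i)

count-unique : (P? : Decidable P) → (∀ {i j} → P i → P j → i ≡ j) → count P? ≡ 𝟙 (any? P?)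
count-unique P? unique with any? P?
... | no ∄P = count-empty P? (λ i Pi → ∄P (i , Pi))
... | yes (i , Pi) =
  trans (count-cong P? (_≟ᶠ i) (λ Pj → unique Pj Pi) (λ { refl → Pi })) (count-singleton i)

prime>1 : Prime p → 1 < p
prime>1 {p} p-prime = nonTrivial⇒n>1 p {{prime⇒nonTrivial p-prime}}

prime∤⇒coprime : Prime p → ¬ p ∣ m → Coprime m p
prime∤⇒coprime p-prime p∤m (d∣m , d∣p) with prime⇒irreducible p-prime d∣p
... | inj₁ d≡1 = d≡1
... | inj₂ refl = contradiction d∣m p∤m

^-∣-^ : ∀ m {k l} → k ≤ l → m ^ k ∣ m ^ l
^-∣-^ m {k} {l} k≤l = divides (m ^ (l ∸ k)) (begin
  m ^ l               ≡⟨ cong (m ^_) (m+[n∸m]≡n k≤l) ⟨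
  m ^ (k + (l ∸ k))   ≡⟨ ^-distribˡ-+-* m k (l ∸ k) ⟩
  m ^ k * m ^ (l ∸ k) ≡⟨ *-comm (m ^ k) _ ⟩
  m ^ (l ∸ k) * m ^ k ∎)
  where open ≡-Reasoning

prime-power-divisor : Prime p → ∀ k → d ∣ p ^ k → ∃[ l ] l ≤ k × d ≡ p ^ l
prime-power-divisor p-prime zero d∣1 = 0 , z≤n , ∣1⇒≡1 d∣1
prime-power-divisor {p} {d} p-prime (suc k) d∣p^sk with p ∣? d
... | no p∤d
  with l , l≤k , d≡ ← prime-power-divisor p-prime k
                        (coprime-divisor (prime∤⇒coprime p-prime p∤d) d∣p^sk)
  = l , m≤n⇒m≤1+n l≤k , d≡
... | yes (divides e refl)
  with l , l≤k , e≡ ← prime-power-divisor {d = e} p-prime k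
         (*-cancelʳ-∣ p {{prime⇒nonZero p-prime}} (subst (e * p ∣_) (*-comm p (p ^ k)) d∣p^sk))
  = suc l , s≤s l≤k , trans (cong (_* p) e≡) (*-comm (p ^ l) p)

prime∣^⇒≡ : Prime p → Prime q → ∀ k → p ∣ q ^ k → p ≡ q
prime∣^⇒≡ p-prime q-prime zero p∣1 = contradiction (∣1⇒≡1 p∣1) (>⇒≢ (prime>1 p-prime))
prime∣^⇒≡ {p} {q} p-prime q-prime (suc k) p∣q^sk with euclidsLemma q (q ^ k) p-prime p∣q^sk
... | inj₂ p∣q^k = prime∣^⇒≡ p-prime q-prime k p∣q^k
... | inj₁ p∣q with prime⇒irreducible q-prime p∣q
...   | inj₁ p≡1 = contradiction p≡1 (>⇒≢ (prime>1 p-prime))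
...   | inj₂ p≡q = p≡q

coprime-^ : Prime q → Coprime m q → ∀ k → Coprime (q ^ k) m
coprime-^ {q} q-prime m⊥q k (d∣q^k , d∣m) with prime-power-divisor q-prime k d∣q^k
... | zero  , _ , d≡1 = d≡1
... | suc l , _ , refl =
  contradiction (m⊥q (∣-trans (m∣m*n (q ^ l)) d∣m , ∣-refl)) (>⇒≢ (prime>1 q-prime))

prime-factors-≡⇒power : Prime q → ∀ m → .{{NonZero m}} → (∀ {p} → Prime p → p ∣ m → p ≡ q) →
                        ∃[ a ] m ≡ q ^ a
prime-factors-≡⇒power {q} q-prime m only-q =
  length ps , trans isFactorisation (product≡power ps factorsPrime
    λ p-prime p∣ → only-q p-prime (subst (_ ∣_) (sym isFactorisation) p∣))
  where
  open PrimeFactorisation (factorise m) renaming (factors to ps)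
  product≡power : ∀ ps → All Prime ps → (∀ {p} → Prime p → p ∣ product ps → p ≡ q) →
                  product ps ≡ q ^ length ps
  product≡power []       []               _      = refl
  product≡power (p ∷ ps) (p-prime ∷ prime) only-q =
    cong₂ _*_ (only-q p-prime (m∣m*n (product ps)))
              (product≡power ps prime λ p′-prime p′∣ → only-q p′-prime (∣n⇒∣m*n p p′∣))

^-cancelˡ-< : ∀ m .{{_ : NonZero m}} {a b} → m ^ a < m ^ b → a < b
^-cancelˡ-< m {a} {b} m^a<m^b with a <? b
... | yes a<b = a<b
... | no a≮b = contradiction (^-monoʳ-≤ m (≮⇒≥ a≮b)) (<⇒≱ m^a<m^b)


powers-<⇒*-≤ : ∀ q .{{_ : NonZero q}} {m m′} →
               ∃[ a ] m ≡ q ^ a → ∃[ b ] m′ ≡ q ^ b → m < m′ → q * m ≤ m′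
powers-<⇒*-≤ q (a , refl) (b , refl) q^a<q^b = ^-monoʳ-≤ q {suc a} {b} (^-cancelˡ-< q q^a<q^b)

*-≤⇒≤∸ : 1 < q → q * m ≤ d → m ≤ d ∸ m
*-≤⇒≤∸ {q} {m} {d} 1<q qm≤d = m+n≤o⇒m≤o∸n m (begin
  m + m     ≡⟨ cong (m +_) (+-identityʳ m) ⟨
  2 * m     ≤⟨ *-monoˡ-≤ m 1<q ⟩
  q * m     ≤⟨ qm≤d ⟩
  d         ∎)
  where open ≤-Reasoning

module _ {ℓ} {P : ℕ → Set ℓ} (P? : ∀ k → Dec (P k)) where

  private
    least-from-below : ∀ b → (∀ {k} → P k → b ≤ k) ⊎ ∃[ r ] P r × (∀ {k} → P k → r ≤ k)
    least-from-below zero = inj₁ (λ _ → z≤n)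
    least-from-below (suc b) with least-from-below b
    ... | inj₂ found = inj₂ found
    ... | inj₁ b≤ with P? b
    ...   | yes Pb = inj₂ (b , Pb , b≤)
    ...   | no ¬Pb = inj₁ λ {k} Pk → ≤∧≢⇒< (b≤ Pk) λ { refl → ¬Pb Pk }

  least-witness : ∀ {m} → P m → ∃[ r ] P r × (∀ {k} → P k → r ≤ k)
  least-witness {m} Pm with least-from-below (suc m)
  ... | inj₁ sm≤ = contradiction (sm≤ Pm) (n≮n m)
  ... | inj₂ r = r

module FiniteAbelianGroupProperties {n : ℕ} (G : FiniteAbelianGroup n) where

  open FiniteAbelianGroup G

  private
    abelianGroup : AbelianGroup 0ℓ 0ℓ
    abelianGroup = record { isAbelianGroup = isAbelianGroup }

  open AbelianGroup abelianGroup
    using (group; commutativeMonoid; commutativeSemigroup; assoc; comm; identityˡ; identityʳ)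
  open import Algebra.Properties.Group group using (identityʳ-unique; //-rightDividesˡ; //-rightDividesʳ)
  open import Algebra.Properties.CommutativeMonoid.Mult commutativeMonoid
    using (×-homo-+; ×-assocˡ; ×-distrib-+) renaming (_×_ to _⋆_)
  open import Algebra.Properties.CommutativeSemigroup commutativeSemigroup using (interchange)

  pow≗× : ∀ x k → pow G x k ≡ k ⋆ x
  pow≗× x zero    = refl
  pow≗× x (suc k) = cong (x ∙_) (pow≗× x k)

  pow-+ : ∀ x i j → pow G x (i + j) ≡ pow G x i ∙ pow G x j
  pow-+ x i j rewrite pow≗× x (i + j) | pow≗× x i | pow≗× x j = ×-homo-+ x i j

  pow-* : ∀ x i j → pow G x (i * j) ≡ pow G (pow G x j) i
  pow-* x i j rewrite pow≗× x (i * j) | pow≗× (pow G x j) i | pow≗× x j = sym (×-assocˡ x i j)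

  pow-∙ : ∀ x y k → pow G (x ∙ y) k ≡ pow G x k ∙ pow G y k
  pow-∙ x y k rewrite pow≗× (x ∙ y) k | pow≗× x k | pow≗× y k = ×-distrib-+ x y k

  pow-ε : ∀ k → pow G ε k ≡ ε
  pow-ε zero    = refl
  pow-ε (suc k) = trans (cong (ε ∙_) (pow-ε k)) (identityˡ ε)

  pow-comm : ∀ x i j → pow G (pow G x i) j ≡ pow G (pow G x j) i
  pow-comm x i j = trans (sym (pow-* x j i)) (trans (cong (pow G x) (*-comm j i)) (pow-* x i j))

  pow-periodic : ∀ x → ∃[ s ] pow G x (suc s) ≡ ε
  pow-periodic x
    with i , j , i<j , x^i≡x^j ← pigeonhole (n<1+n n) (λ (i : Fin (suc n)) → pow G x (toℕ i)) =
    s , identityʳ-unique (pow G x (toℕ i)) _ (begin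
      pow G x (toℕ i) ∙ pow G x (suc s) ≡⟨ pow-+ x (toℕ i) (suc s) ⟨
      pow G x (toℕ i + suc s)           ≡⟨ cong (pow G x) (trans (+-suc (toℕ i) s) (m+[n∸m]≡n i<j)) ⟩
      pow G x (toℕ j)                   ≡⟨ x^i≡x^j ⟨
      pow G x (toℕ i)                   ∎)
    where
    open ≡-Reasoning
    s : ℕ
    s = toℕ j ∸ suc (toℕ i)

  record Submonoid : Set₁ where
    field
      Member   : Pred (Fin n) 0ℓ
      member?  : Decidable Member
      ε-closed : Member ε
      ∙-closed : ∀ {x y} → Member x → Member y → Member (x ∙ y)

  open Submonoid public

  infix 4 _∈_ _∉_ _⊆ₛ_

  _∈_ : Fin n → Submonoid → Set
  x ∈ K = Member K x

  _∉_ : Fin n → Submonoid → Set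
  x ∉ K = ¬ x ∈ K

  _⊆ₛ_ : Submonoid → Submonoid → Set
  K ⊆ₛ X = ∀ {x} → x ∈ K → x ∈ X

  card : Submonoid → ℕ
  card K = count (member? K)

  card-pos : ∀ K → 0 < card K
  card-pos K = count-pos (member? K) ε (ε-closed K)

  card-mono : ∀ K X → K ⊆ₛ X → card K ≤ card X
  card-mono K X = count-mono (member? K) (member? X)

  card-mono-< : ∀ K X → K ⊆ₛ X → ∀ x → x ∈ X → x ∉ K → card K < card X
  card-mono-< K X = count-mono-< (member? K) (member? X)

  module _ (K : Submonoid) where

    pow-closed : ∀ {x} k → x ∈ K → pow G x k ∈ K
    pow-closed zero    x∈K = ε-closed K
    pow-closed (suc k) x∈K = ∙-closed K x∈K (pow-closed k x∈K)

    -- A submonoid of a finite group is a subgroup: y⁻¹ is a power of y.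
    cancelʳ-closed : ∀ {x y} → x ∙ y ∈ K → y ∈ K → x ∈ K
    cancelʳ-closed {x} {y} xy∈K y∈K with s , y^s+1≡ε ← pow-periodic y =
      subst (_∈ K) x∙y∙y^s≡x (∙-closed K xy∈K (pow-closed s y∈K))
      where
      x∙y∙y^s≡x : (x ∙ y) ∙ pow G y s ≡ x
      x∙y∙y^s≡x = trans (assoc x y _) (trans (cong (x ∙_) y^s+1≡ε) (identityʳ x))

    cancelˡ-closed : ∀ {x y} → x ∙ y ∈ K → x ∈ K → y ∈ K
    cancelˡ-closed {x} {y} xy∈K = cancelʳ-closed (subst (_∈ K) (comm x y) xy∈K)

    pow-bézout-closed : ∀ {x d a b} → Bézout.Identity d a b →
                        pow G x a ∈ K → pow G x b ∈ K → pow G x d ∈ K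
    pow-bézout-closed {x} {d} {a} {b} (Bézout.+- u v d+vb≡ua) x^a∈K x^b∈K =
      cancelʳ-closed (subst (_∈ K) x^ua≡x^d∙x^vb (pow-closed u x^a∈K))
                     (subst (_∈ K) (sym (pow-* x v b)) (pow-closed v x^b∈K))
      where
      x^ua≡x^d∙x^vb : pow G (pow G x a) u ≡ pow G x d ∙ pow G x (v * b)
      x^ua≡x^d∙x^vb = trans (sym (pow-* x u a)) (trans (cong (pow G x) (sym d+vb≡ua)) (pow-+ x d (v * b)))
    pow-bézout-closed (Bézout.-+ u v eq) x^a∈K x^b∈K =
      pow-bézout-closed (Bézout.+- v u eq) x^b∈K x^a∈K

    card-translate : ∀ g → sum (λ x → 𝟙 (member? K (x ∙ g))) ≡ card K
    card-translate g = sym (sum-permute (λ x → 𝟙 (member? K x))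
      (permutation (_∙ g) (_∙ (g ⁻¹)) (//-rightDividesˡ g) (//-rightDividesʳ g)))

  trivial : Submonoid
  trivial = record
    { Member = _≡ ε ; member? = _≟ᶠ ε ; ε-closed = refl
    ; ∙-closed = λ { refl refl → identityˡ ε } }

  full : Submonoid
  full = record
    { Member = λ _ → ⊤ ; member? = λ _ → yes tt ; ε-closed = tt
    ; ∙-closed = λ _ _ → tt }

  torsion : ℕ → Submonoid
  torsion m = record
    { Member = λ x → pow G x m ≡ ε ; member? = λ x → pow G x m ≟ᶠ ε ; ε-closed = pow-ε m
    ; ∙-closed = λ {x} {y} x^m≡ε y^m≡ε →
        trans (pow-∙ x y m) (trans (cong₂ _∙_ x^m≡ε y^m≡ε) (identityˡ ε)) }

  card-trivial : card trivial ≡ 1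
  card-trivial = count-singleton ε

  card-full : card full ≡ n
  card-full = count-universal (member? full) (λ _ → tt)

  trivial⊆ : ∀ K → trivial ⊆ₛ K
  trivial⊆ K refl = ε-closed K

  torsion-mono : ∀ {m m′} → m ∣ m′ → torsion m ⊆ₛ torsion m′
  torsion-mono {m} (divides k refl) {x} x^m≡ε =
    trans (pow-* x k m) (trans (cong (λ y → pow G y k) x^m≡ε) (pow-ε k))

  pow-gcd≡ε : ∀ x a b → pow G x a ≡ ε → pow G x b ≡ ε → pow G x (gcd a b) ≡ ε
  pow-gcd≡ε x a b = pow-bézout-closed trivial (Bézout.identity (gcd-GCD a b))

  -- X/K has order index, and Cauchy's theorem holds in the quotient X/K.
  record CauchyIndex (K X : Submonoid) : Set where
    field
      index  : ℕ
      card≡  : card X ≡ index * card K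
      cauchy-quotient : ∀ {p} → Prime p → p ∣ index → ∃[ x ] x ∈ X × x ∉ K × pow G x p ∈ K

  open CauchyIndex

  index-one : ∀ {K X} → K ⊆ₛ X → X ⊆ₛ K → CauchyIndex K X
  index-one {K} {X} K⊆X X⊆K = record
    { index  = 1
    ; card≡  = trans (count-cong (member? X) (member? K) X⊆K K⊆X) (sym (*-identityˡ (card K)))
    ; cauchy-quotient = λ p-prime p∣1 → contradiction (∣1⇒≡1 p∣1) (>⇒≢ (prime>1 p-prime))
    }

  -- K⟨y⟩ is the subgroup generated by K and y, and r is the order of y modulo K.
  module Adjoin (K : Submonoid) (y : Fin n) (r₀ : ℕ) (y^r∈K : pow G y (suc r₀) ∈ K)
                (r-least : ∀ {k} → pow G y (suc k) ∈ K → r₀ ≤ k) where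

    r : ℕ
    r = suc r₀

    InK⟨y⟩ : Pred (Fin n) 0ℓ
    InK⟨y⟩ x = ∃[ i ] x ∙ pow G y (toℕ {r} i) ∈ K

    reduce : ∀ {x} k → x ∙ pow G y k ∈ K → InK⟨y⟩ x
    reduce {x} k xy^k∈K =
      k mod r , cancelʳ-closed K (subst (_∈ K) split xy^k∈K) (pow-closed K (k / r) y^r∈K)
      where
      open ≡-Reasoning
      split : x ∙ pow G y k ≡ (x ∙ pow G y (toℕ (k mod r))) ∙ pow G (pow G y r) (k / r)
      split = begin
        x ∙ pow G y k                                ≡⟨ cong (λ e → x ∙ pow G y e) (m≡m%n+[m/n]*n k r) ⟩
        x ∙ pow G y (k % r + k / r * r)              ≡⟨ cong (x ∙_) (pow-+ y (k % r) _) ⟩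
        x ∙ (pow G y (k % r) ∙ pow G y (k / r * r))  ≡⟨ assoc x _ _ ⟨
        (x ∙ pow G y (k % r)) ∙ pow G y (k / r * r)  ≡⟨ cong₂ (λ e f → (x ∙ pow G y e) ∙ f)
                                                              (toℕ-fromℕ< (m%n<n k r)) (sym (pow-* y (k / r) r)) ⟨
        (x ∙ pow G y (toℕ (k mod r))) ∙ pow G (pow G y r) (k / r) ∎

    K⟨y⟩ : Submonoid
    K⟨y⟩ = record
      { Member   = InK⟨y⟩
      ; member?  = λ x → any? (λ i → member? K (x ∙ pow G y (toℕ i)))
      ; ε-closed = zero , subst (_∈ K) (sym (identityˡ ε)) (ε-closed K)
      ; ∙-closed = λ { {x} {x′} (i , xy^i∈K) (j , x′y^j∈K) → reduce (toℕ i + toℕ j)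
          (subst (_∈ K) (trans (interchange x _ x′ _) (cong ((x ∙ x′) ∙_) (sym (pow-+ y (toℕ i) (toℕ j)))))
                        (∙-closed K xy^i∈K x′y^j∈K)) }
      }

    K⊆K⟨y⟩ : K ⊆ₛ K⟨y⟩
    K⊆K⟨y⟩ {x} x∈K = zero , subst (_∈ K) (sym (identityʳ x)) x∈K

    y∈K⟨y⟩ : y ∈ K⟨y⟩
    y∈K⟨y⟩ = fromℕ r₀ , subst (λ e → y ∙ pow G y e ∈ K) (sym (toℕ-fromℕ r₀)) y^r∈K

    K⟨y⟩⊆ : ∀ {X} → K ⊆ₛ X → y ∈ X → K⟨y⟩ ⊆ₛ X
    K⟨y⟩⊆ {X} K⊆X y∈X (i , xy^i∈K) = cancelʳ-closed X (K⊆X xy^i∈K) (pow-closed X (toℕ i) y∈X)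

    pow-r-closed : ∀ {x} → x ∈ K⟨y⟩ → pow G x r ∈ K
    pow-r-closed {x} (i , xy^i∈K) =
      cancelʳ-closed K (subst (_∈ K) (pow-∙ x _ r) (pow-closed K r xy^i∈K))
                       (subst (_∈ K) (pow-comm y r (toℕ i)) (pow-closed K (toℕ i) y^r∈K))

    private
      no-smaller-offset : ∀ {x i j} → i < j → j < r → x ∙ pow G y i ∈ K → x ∙ pow G y j ∉ K
      no-smaller-offset {x} {i} {j} i<j j<r xy^i∈K xy^j∈K =
        <⇒≱ s<r₀ (r-least (cancelˡ-closed K (subst (_∈ K) xy^j≡xy^i∙y^s+1 xy^j∈K) xy^i∈K))
        where
        s : ℕ
        s = j ∸ suc i
        i+s+1≡j : i + suc s ≡ j
        i+s+1≡j = trans (+-suc i s) (m+[n∸m]≡n i<j)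
        s<r₀ : s < r₀
        s<r₀ = ≤-trans (subst (suc s ≤_) i+s+1≡j (m≤n+m (suc s) i)) (s≤s⁻¹ j<r)
        xy^j≡xy^i∙y^s+1 : x ∙ pow G y j ≡ (x ∙ pow G y i) ∙ pow G y (suc s)
        xy^j≡xy^i∙y^s+1 = trans (cong (λ e → x ∙ pow G y e) (sym i+s+1≡j))
                                (trans (cong (x ∙_) (pow-+ y i (suc s))) (sym (assoc x _ _)))

    offset-unique : ∀ {x} {i j : Fin r} →
                    x ∙ pow G y (toℕ i) ∈ K → x ∙ pow G y (toℕ j) ∈ K → i ≡ j
    offset-unique {i = i} {j} xy^i∈K xy^j∈K with <-cmp (toℕ i) (toℕ j)
    ... | tri< i<j _ _ = contradiction xy^j∈K (no-smaller-offset i<j (toℕ<n j) xy^i∈K)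
    ... | tri≈ _ i≡j _ = toℕ-injective i≡j
    ... | tri> _ _ j<i = contradiction xy^i∈K (no-smaller-offset j<i (toℕ<n i) xy^j∈K)

    card-K⟨y⟩ : card K⟨y⟩ ≡ r * card K
    card-K⟨y⟩ = begin
      sum (λ x → 𝟙 (member? K⟨y⟩ x))  ≡⟨ sum-cong-≗ {n} (λ x → count-unique (χ? x) offset-unique) ⟨
      sum (λ x → sum (λ i → χ x i))   ≡⟨ ∑-comm {n} {r} χ ⟩
      sum (λ i → sum (λ x → χ x i))   ≡⟨ sum-cong-≗ {r} (λ i → card-translate K (pow G y (toℕ i))) ⟩
      sum {r} (λ _ → card K)          ≡⟨ sum-const r (card K) ⟩
      r * card K                      ∎
      where
      open ≡-Reasoning
      χ? : ∀ x → Decidable (λ (i : Fin r) → x ∙ pow G y (toℕ i) ∈ K)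
      χ? x i = member? K (x ∙ pow G y (toℕ i))
      χ : Fin n → Fin r → ℕ
      χ x i = 𝟙 (χ? x i)

    extend : ∀ {X} → y ∈ X → CauchyIndex K⟨y⟩ X → CauchyIndex K X
    extend {X} y∈X I = record
      { index  = index I * r
      ; card≡  = trans (card≡ I) (trans (cong (index I *_) card-K⟨y⟩)
                                        (sym (*-assoc (index I) r (card K))))
      ; cauchy-quotient = cauchy′
      }
      where
      y^w∉K : ∀ {p} w → Prime p → r ≡ w * p → pow G y w ∉ K
      y^w∉K zero       _       ()
      y^w∉K {p} (suc w) p-prime r≡wp y^w∈K =
        <⇒≱ (s≤s⁻¹ (subst (suc w <_) (sym r≡wp) (m<m*n (suc w) p (prime>1 p-prime))))
            (r-least y^w∈K)

      cauchy′ : ∀ {p} → Prime p → p ∣ index I * r → ∃[ x ] x ∈ X × x ∉ K × pow G x p ∈ K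
      cauchy′ {p} p-prime p∣cr with p ∣? r
      ... | yes (divides w r≡wp) = pow G y w , pow-closed X w y∈X , y^w∉K w p-prime r≡wp ,
            subst (_∈ K) (trans (cong (pow G y) (trans r≡wp (*-comm w p))) (pow-* y p w)) y^r∈K
      -- For p ∤ r, the r-th power of a witness for X/K⟨y⟩ is a witness for X/K.
      ... | no p∤r with euclidsLemma (index I) r p-prime p∣cr
      ...   | inj₂ p∣r = contradiction p∣r p∤r
      ...   | inj₁ p∣c with x , x∈X , x∉K⟨y⟩ , x^p∈K⟨y⟩ ← cauchy-quotient I p-prime p∣c =
        pow G x r , pow-closed X r x∈X , x^r∉K ,
        subst (_∈ K) (pow-comm x p r) (pow-r-closed x^p∈K⟨y⟩)
        where
        x^r∉K : pow G x r ∉ K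
        x^r∉K x^r∈K = x∉K⟨y⟩ (subst (_∈ K⟨y⟩) (identityʳ x)
          (pow-bézout-closed K⟨y⟩ (coprime-Bézout (prime∤⇒coprime p-prime p∤r))
                                   (K⊆K⟨y⟩ x^r∈K) x^p∈K⟨y⟩))

  private
    -- Each adjunction strictly enlarges K inside X.
    cauchy-index-fuel : ∀ fuel {K X} → K ⊆ₛ X → card X ≤ fuel + card K → CauchyIndex K X
    cauchy-index-fuel fuel {K} {X} K⊆X bound with any? (λ x → member? X x ×-dec ¬? (member? K x))
    ... | no ∄x =
      index-one K⊆X (λ {x} x∈X → decidable-stable (member? K x) (λ x∉K → ∄x (x , x∈X , x∉K)))
    ... | yes (y , y∈X , y∉K)
      with s , y^s+1≡ε ← pow-periodic y
      with r₀ , y^r∈K , r-least ← least-witness (λ k → member? K (pow G y (suc k))) {s}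
                                    (subst (_∈ K) (sym y^s+1≡ε) (ε-closed K))
      = adjoin fuel bound
      where
      open Adjoin K y r₀ y^r∈K r-least
      K<X : card K < card X
      K<X = card-mono-< K X K⊆X y y∈X y∉K
      K<K⟨y⟩ : card K < card K⟨y⟩
      K<K⟨y⟩ = card-mono-< K K⟨y⟩ K⊆K⟨y⟩ y y∈K⟨y⟩ y∉K
      adjoin : ∀ fuel → card X ≤ fuel + card K → CauchyIndex K X
      adjoin zero    bound = contradiction bound (<⇒≱ K<X)
      adjoin (suc f) bound = extend y∈X (cauchy-index-fuel f (K⟨y⟩⊆ {X} K⊆X y∈X)
        (≤-trans bound (subst (_≤ f + card K⟨y⟩) (+-suc f (card K)) (+-monoʳ-≤ f K<K⟨y⟩))))

  cauchy-index : ∀ {K X} → K ⊆ₛ X → CauchyIndex K X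
  cauchy-index {K} {X} K⊆X = cauchy-index-fuel (card X) K⊆X (m≤m+n (card X) (card K))

  lagrange : ∀ {K X} → K ⊆ₛ X → card K ∣ card X
  lagrange {K} {X} K⊆X = divides (index I) (card≡ I)
    where
    I : CauchyIndex K X
    I = cauchy-index K⊆X

  cauchy : ∀ X {p} → Prime p → p ∣ card X → ∃[ x ] x ∈ X × x ≢ ε × pow G x p ≡ ε
  cauchy X p-prime p∣X = cauchy-quotient I p-prime (subst (_ ∣_) X≡c p∣X)
    where
    I : CauchyIndex trivial X
    I = cauchy-index (trivial⊆ X)
    X≡c : card X ≡ index I
    X≡c = trans (card≡ I) (trans (cong (index I *_) card-trivial) (*-identityʳ (index I)))

  module PrimaryTorsion {q} (q-prime : Prime q) where

    instance
      q≢0 : NonZero q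
      q≢0 = prime⇒nonZero q-prime

    qTorsion : ℕ → Submonoid
    qTorsion k = torsion (q ^ k)

    torsionCard : ℕ → ℕ
    torsionCard k = card (qTorsion k)

    qTorsion-mono : ∀ {k l} → k ≤ l → qTorsion k ⊆ₛ qTorsion l
    qTorsion-mono {k} {l} k≤l = torsion-mono {q ^ k} {q ^ l} (^-∣-^ q k≤l)

    torsionCard-zero : torsionCard 0 ≡ 1
    torsionCard-zero = trans (count-cong (member? (qTorsion 0)) (member? trivial)
                                         (λ {x} x∙ε≡ε → trans (sym (identityʳ x)) x∙ε≡ε)
                                         (λ { refl → pow-ε 1 }))
                             card-trivial

    torsionCard-mono : ∀ {k l} → k ≤ l → torsionCard k ≤ torsionCard l
    torsionCard-mono {k} {l} k≤l = card-mono (qTorsion k) (qTorsion l) (qTorsion-mono k≤l)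

    pow-below-prime-power : ∀ {x k j} → pow G x (q ^ suc k) ≡ ε →
                            0 < j → j < q ^ suc k → pow G x j ≡ ε → x ∈ qTorsion k
    pow-below-prime-power {x} {k} {j} x^q^k+1≡ε 0<j j<q^k+1 x^j≡ε
      with l , _ , d≡q^l ← prime-power-divisor q-prime (suc k) (gcd[m,n]∣n j (q ^ suc k)) =
      qTorsion-mono (s≤s⁻¹ l<k+1) (subst (λ e → pow G x e ≡ ε) d≡q^l x^d≡ε)
      where
      x^d≡ε : pow G x (gcd j (q ^ suc k)) ≡ ε
      x^d≡ε = pow-gcd≡ε x j (q ^ suc k) x^j≡ε x^q^k+1≡ε
      l<k+1 : l < suc k
      l<k+1 = ^-cancelˡ-< q (subst (_< q ^ suc k) d≡q^l
                (≤-<-trans (∣⇒≤ {{>-nonZero 0<j}} (gcd[m,n]∣m j (q ^ suc k))) j<q^k+1))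

    hasOrder⇒ : ∀ {x k} → HasOrder G x (q ^ suc k) → x ∈ qTorsion (suc k) × x ∉ qTorsion k
    hasOrder⇒ {x} {k} (_ , x^q^k+1≡ε , minimal) = x^q^k+1≡ε , λ x^q^k≡ε →
      minimal (fromℕ< q^k<q^k+1) (subst (0 <_) (sym (toℕ-fromℕ< q^k<q^k+1)) (m^n>0 q k))
                                 (subst (λ e → pow G x e ≡ ε) (sym (toℕ-fromℕ< q^k<q^k+1)) x^q^k≡ε)
      where
      q^k<q^k+1 : q ^ k < q ^ suc k
      q^k<q^k+1 = ^-monoʳ-< q (prime>1 q-prime) (n<1+n k)

    hasOrder⇐ : ∀ {x k} → x ∈ qTorsion (suc k) × x ∉ qTorsion k → HasOrder G x (q ^ suc k)
    hasOrder⇐ {x} {k} (x^q^k+1≡ε , x^q^k≢ε) = m^n>0 q (suc k) , x^q^k+1≡ε ,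
      λ j 0<j x^j≡ε → x^q^k≢ε (pow-below-prime-power {x} {k} x^q^k+1≡ε 0<j (toℕ<n j) x^j≡ε)

    torsionCard-suc : ∀ k → torsionCard (suc k) ≡ torsionCard k + φ G (q ^ suc k)
    torsionCard-suc k = begin
      torsionCard (suc k)                     ≡⟨ count-split T? T′? (qTorsion-mono (n≤1+n k)) ⟩
      torsionCard k + count new?              ≡⟨ cong (torsionCard k +_) (count-cong new? order?
                                                   (hasOrder⇐ {k = k}) (hasOrder⇒ {k = k})) ⟩
      torsionCard k + count order?            ≡⟨ cong (torsionCard k +_) (length-filter-allFin order?) ⟨
      torsionCard k + φ G (q ^ suc k)         ∎
      where
      open ≡-Reasoning
      T? : Decidable (Member (qTorsion k))
      T? = member? (qTorsion k)
      T′? : Decidable (Member (qTorsion (suc k)))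
      T′? = member? (qTorsion (suc k))
      new? : Decidable (λ x → x ∈ qTorsion (suc k) × x ∉ qTorsion k)
      new? x = T′? x ×-dec ¬? (T? x)
      order? : Decidable (λ x → HasOrder G x (q ^ suc k))
      order? = hasOrder? G (q ^ suc k)

    torsionCard-power : ∀ k → ∃[ a ] torsionCard k ≡ q ^ a
    torsionCard-power k =
      prime-factors-≡⇒power q-prime (torsionCard k) {{>-nonZero (card-pos (qTorsion k))}} only-q
      where
      only-q : ∀ {p} → Prime p → p ∣ torsionCard k → p ≡ q
      only-q {p} p-prime p∣ with p ≟ q
      ... | yes p≡q = p≡q
      ... | no p≢q with x , x^q^k≡ε , x≢ε , x^p≡ε ← cauchy (qTorsion k) p-prime p∣ =
        contradiction (trans (sym (identityʳ x)) (subst (λ e → pow G x e ≡ ε) q^k⊓p≡1 x^q^k⊓p≡ε)) x≢ε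
        where
        x^q^k⊓p≡ε : pow G x (gcd (q ^ k) p) ≡ ε
        x^q^k⊓p≡ε = pow-gcd≡ε x (q ^ k) p x^q^k≡ε x^p≡ε
        q^k⊓p≡1 : gcd (q ^ k) p ≡ 1
        q^k⊓p≡1 = coprime⇒gcd≡1 (prime∤⇒coprime p-prime
                    λ p∣q^k → p≢q (prime∣^⇒≡ p-prime q-prime k p∣q^k))

    torsionCard-≤ : ∀ {δ n′} → n ≡ q ^ δ * n′ → Coprime n′ q → ∀ k → torsionCard k ≤ q ^ δ
    torsionCard-≤ {δ} {n′} n≡ n′⊥q k with a , N≡q^a ← torsionCard-power k =
      subst (_≤ q ^ δ) (sym N≡q^a)
            (∣⇒≤ {{m^n≢0 q δ}} (coprime-divisor (coprime-^ q-prime n′⊥q a) q^a∣n′q^δ))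
      where
      q^a∣n′q^δ : q ^ a ∣ n′ * q ^ δ
      q^a∣n′q^δ = subst₂ _∣_ N≡q^a (trans card-full (trans n≡ (*-comm (q ^ δ) n′)))
                          (lagrange {qTorsion k} {full} (λ _ → tt))

    -- Cauchy's theorem in G/G[q^k] provides x ∉ G[q^k] with x^q ∈ G[q^k].
    torsionCard-grows : ∀ k {a} → torsionCard k ≡ q ^ a → q ^ suc a ∣ n →
                        torsionCard k < torsionCard (suc k)
    torsionCard-grows k {a} N≡q^a q^a+1∣n = grow (cauchy-quotient I q-prime q∣index)
      where
      I : CauchyIndex (qTorsion k) full
      I = cauchy-index (λ _ → tt)
      q∣index : q ∣ index I
      q∣index = *-cancelʳ-∣ (q ^ a) {{m^n≢0 q a}}
        (subst (q ^ suc a ∣_) (trans (sym card-full) (trans (card≡ I) (cong (index I *_) N≡q^a)))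
               q^a+1∣n)
      grow : ∃[ x ] x ∈ full × x ∉ qTorsion k × pow G x q ∈ qTorsion k →
             torsionCard k < torsionCard (suc k)
      grow (x , _ , x∉T , x^q∈T) =
        card-mono-< (qTorsion k) (qTorsion (suc k)) (qTorsion-mono (n≤1+n k)) x x^q^k+1≡ε x∉T
        where
        x^q^k+1≡ε : pow G x (q * q ^ k) ≡ ε
        x^q^k+1≡ε = trans (pow-* x q (q ^ k)) (trans (sym (pow-comm x q (q ^ k))) x^q∈T)

    torsionCard-≥ : ∀ k → q ^ k ∣ n → q ^ k ≤ torsionCard k
    torsionCard-≥ zero    _ = card-pos (qTorsion 0)
    torsionCard-≥ (suc k) q^k+1∣n with a , N≡q^a ← torsionCard-power k | k <? a
    ... | yes k<a =
      ≤-trans (subst (q ^ suc k ≤_) (sym N≡q^a) (^-monoʳ-≤ q k<a)) (torsionCard-mono (n≤1+n k))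
    ... | no k≮a = begin
      q * q ^ k              ≤⟨ *-monoʳ-≤ q (torsionCard-≥ k (∣-trans (^-∣-^ q (n≤1+n k)) q^k+1∣n)) ⟩
      q * torsionCard k      ≤⟨ powers-<⇒*-≤ q (a , N≡q^a) (torsionCard-power (suc k)) N<N′ ⟩
      torsionCard (suc k)    ∎
      where
      open ≤-Reasoning
      N<N′ : torsionCard k < torsionCard (suc k)
      N<N′ = torsionCard-grows k {a} N≡q^a (∣-trans (^-∣-^ q (s≤s (≮⇒≥ k≮a))) q^k+1∣n)

module _ {n m} (G : FiniteAbelianGroup n) (H : FiniteAbelianGroup m) {q} (q-prime : Prime q) where

  private
    module TG = FiniteAbelianGroupProperties.PrimaryTorsion G q-prime
    module TH = FiniteAbelianGroupProperties.PrimaryTorsion H q-prime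

  AgreeUpTo : ℕ → Set
  AgreeUpTo t = ∀ i → 1 ≤ i → i ≤ t → φ G (q ^ i) ≡ φ H (q ^ i)

  torsionCard-agree : ∀ t → AgreeUpTo t → TG.torsionCard t ≡ TH.torsionCard t
  torsionCard-agree zero    _       = trans TG.torsionCard-zero (sym TH.torsionCard-zero)
  torsionCard-agree (suc t) φ-agree = begin
    TG.torsionCard (suc t)              ≡⟨ TG.torsionCard-suc t ⟩
    TG.torsionCard t + φ G (q ^ suc t)  ≡⟨ cong₂ _+_ (torsionCard-agree t λ i 1≤i i≤t → φ-agree i 1≤i (m≤n⇒m≤1+n i≤t))
                                                     (φ-agree (suc t) (s≤s z≤n) ≤-refl) ⟩
    TH.torsionCard t + φ H (q ^ suc t)  ≡⟨ TH.torsionCard-suc t ⟨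
    TH.torsionCard (suc t)              ∎
    where open ≡-Reasoning

  torsionCard-suc-< : ∀ t → AgreeUpTo t → φ G (q ^ suc t) < φ H (q ^ suc t) →
                      TG.torsionCard (suc t) < TH.torsionCard (suc t)
  torsionCard-suc-< t φ-agree φG<φH
    rewrite TG.torsionCard-suc t | TH.torsionCard-suc t | torsionCard-agree t φ-agree =
    +-monoʳ-< (TH.torsionCard t) φG<φH

  φ-∸≡torsionCard-∸ : ∀ t → AgreeUpTo t →
                      φ H (q ^ suc t) ∸ φ G (q ^ suc t) ≡ TH.torsionCard (suc t) ∸ TG.torsionCard (suc t)
  φ-∸≡torsionCard-∸ t φ-agree
    rewrite TG.torsionCard-suc t | TH.torsionCard-suc t | torsionCard-agree t φ-agree =
    sym ([m+n]∸[m+o]≡n∸o (TH.torsionCard t) _ _)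

lemma2p4 : (n m : ℕ) (G : FiniteAbelianGroup n) (H : FiniteAbelianGroup m)
    → (q : ℕ) → Prime q
    → (β δ n′ m′ : ℕ) → n ≡ q ^ β * n′ → m ≡ q ^ δ * m′
    → Coprime n′ q → Coprime m′ q
    → (t : ℕ)
    → 1 ≤ t → q ^ t ∣ gcd m n → ¬ (φ G (q ^ t) ≡ φ H (q ^ t))
    → ((k : ℕ) → 1 ≤ k → q ^ k ∣ gcd m n → ¬ (φ G (q ^ k) ≡ φ H (q ^ k)) → t ≤ k)
    → φ G (q ^ t) < φ H (q ^ t)
    → (q ^ (t + 1) ∣ m) × (t < δ)
      × (q ^ t ≤ φ H (q ^ t) ∸ φ G (q ^ t))
      × (φ H (q ^ t) ∸ φ G (q ^ t) ≤ q ^ δ ∸ q ^ t)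
lemma2p4 n m G H q q-prime _ δ _ m′ _ m≡ _ m′⊥q (suc t) (s≤s z≤n) q^t+1∣gcd _ t+1-least φG<φH =
  q^t+2∣m , t+1<δ , lower , upper
  where
  module TG = FiniteAbelianGroupProperties.PrimaryTorsion G q-prime
  module TH = FiniteAbelianGroupProperties.PrimaryTorsion H q-prime
  open TG using (q≢0)
  φ-agree : AgreeUpTo G H q-prime t
  φ-agree i 1≤i i≤t = decidable-stable (φ G (q ^ i) ≟ φ H (q ^ i)) λ φG≢φH →
    <⇒≱ (s≤s i≤t) (t+1-least i 1≤i (∣-trans (^-∣-^ q (m≤n⇒m≤1+n i≤t)) q^t+1∣gcd) φG≢φH)
  A<B : TG.torsionCard (suc t) < TH.torsionCard (suc t)
  A<B = torsionCard-suc-< G H q-prime t φ-agree φG<φH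
  gap : φ H (q ^ suc t) ∸ φ G (q ^ suc t) ≡ TH.torsionCard (suc t) ∸ TG.torsionCard (suc t)
  gap = φ-∸≡torsionCard-∸ G H q-prime t φ-agree
  q^t+1≤A : q ^ suc t ≤ TG.torsionCard (suc t)
  q^t+1≤A = TG.torsionCard-≥ (suc t) (∣-trans q^t+1∣gcd (gcd[m,n]∣n m n))
  B≤q^δ : TH.torsionCard (suc t) ≤ q ^ δ
  B≤q^δ = TH.torsionCard-≤ {δ} m≡ m′⊥q (suc t)
  t+1<δ : suc t < δ
  t+1<δ = ^-cancelˡ-< q (<-≤-trans (≤-<-trans q^t+1≤A A<B) B≤q^δ)
  q^t+2∣m : q ^ (suc t + 1) ∣ m
  q^t+2∣m = ∣-trans (^-∣-^ q (subst (_≤ δ) (+-comm 1 (suc t)) t+1<δ))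
                    (divides m′ (trans m≡ (*-comm (q ^ δ) m′)))
  lower : q ^ suc t ≤ φ H (q ^ suc t) ∸ φ G (q ^ suc t)
  lower = subst (q ^ suc t ≤_) (sym gap) (≤-trans q^t+1≤A (*-≤⇒≤∸ (prime>1 q-prime)
            (powers-<⇒*-≤ q (TG.torsionCard-power (suc t)) (TH.torsionCard-power (suc t)) A<B)))
  upper : φ H (q ^ suc t) ∸ φ G (q ^ suc t) ≤ q ^ δ ∸ q ^ suc t
  upper = subst (_≤ q ^ δ ∸ q ^ suc t) (sym gap) (∸-mono B≤q^δ q^t+1≤A)
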